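{- Let $m\ge 3$ be an integer and let $\mathscr{C}_m=\{\emptyset,\{1\},\{1,2\},\dots,\{1,2,\dots,m-1\}\}$, a code on $m-1$ neurons. Then $\mathrm{CF}(\mathcal{J}_{\mathscr{C}_m})=\{x_i(1-x_j)\mid i,j\in[m-1],\ i>j\}$.
   Context: A neural code on $n$ neurons is a collection of subsets of $[n]$. A pseudo-monomial in $\mathbb{F}_2[x_1,\dots,x_n]$ is a polynomial of the form $\prod_{i\in\sigma}x_i\prod_{j\in\tau}(1-x_j)$ with $\sigma,\tau\subseteq[n]$, $\sigma\cap\tau=\emptyset$. For an ideal $J$, a pseudo-monomial $f\in J$ is minimal if there is no pseudo-monomial $g\in J$ with $\deg g<\deg f$ and $f=hg$ for some polynomial $h$; the canonical form $\mathrm{CF}(J)$ is the set of all minimal pseudo-monomials of $J$. For $v\subseteq[n]$ let $\rho_v=\prod_{i\in v}x_i\prod_{j\in[n]\setminus v}(1-x_j)$. The neural ideal of a code $\mathcal{C}$ on $n$ neurons is $\mathcal{J}_\mathcal{C}=\langle \rho_v\mid v\subseteq[n],\ v\notin\mathcal{C}\rangle\subseteq\mathbb{F}_2[x_1,\dots,x_n]$; here $n=m-1$. -}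

module Defs where

open import Data.Nat using (ℕ; zero; suc; _+_; _<_; _≤_)
open import Data.Nat.Properties using () renaming (_≟_ to _≟ℕ_)
open import Data.Bool using (Bool; true; false; not; if_then_else_)
open import Data.Fin using (Fin; toℕ)
open import Data.Fin.Subset using (Subset; _∈_; _∉_; ∣_∣)
open import Data.Vec using (Vec; replicate; zipWith; tabulate; lookup)
open import Data.Vec.Properties using (≡-dec)
open import Data.List using (List; []; _∷_; _++_; map; concatMap; foldr; allFin)
open import Data.Product using (Σ; ∃; _×_; _,_)
open import Relation.Nullary using (¬_)
open import Relation.Nullary.Decidable using (⌊_⌋)
open import Relation.Binary.PropositionalEquality using (_≡_)
open import Function.Bundles using (_⇔_)

-- The polynomial ring F₂[x₀,…,x_{n-1}] (neurons indexed by Fin n).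
-- A polynomial is a formal sum (list) of monomials (exponent vectors);
-- the coefficient of a monomial α is the parity of its number of
-- occurrences.

Monomial : ℕ → Set
Monomial n = Vec ℕ n

Poly : ℕ → Set
Poly n = List (Monomial n)

coeff : ∀ {n} → Poly n → Monomial n → Bool
coeff p α = foldr (λ β b → if ⌊ ≡-dec _≟ℕ_ β α ⌋ then not b else b) false p

infix 4 _≈_
_≈_ : ∀ {n} → Poly n → Poly n → Set
p ≈ q = ∀ α → coeff p α ≡ coeff q α

0P : ∀ {n} → Poly n
0P = []

1P : ∀ {n} → Poly n
1P {n} = replicate n 0 ∷ []

var : ∀ {n} → Fin n → Poly n
var {n} i = tabulate (λ j → if ⌊ Data.Fin._≟_ i j ⌋ then 1 else 0) ∷ []

infixl 6 _+P_ _-P_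
infixl 7 _*P_

_+P_ : ∀ {n} → Poly n → Poly n → Poly n
p +P q = p ++ q

-- characteristic 2: subtraction is addition
_-P_ : ∀ {n} → Poly n → Poly n → Poly n
p -P q = p ++ q

_*P_ : ∀ {n} → Poly n → Poly n → Poly n
p *P q = concatMap (λ α → map (zipWith _+_ α) q) p

prodP : ∀ {n} → List (Poly n) → Poly n
prodP = foldr _*P_ 1P

sumP : ∀ {n} → List (Poly n) → Poly n
sumP = foldr _+P_ 0P

InIdeal : ∀ {n} → (Poly n → Set) → Poly n → Set
InIdeal {n} G f =
  Σ (List (Σ (Poly n) G × Poly n)) λ hs →
    f ≈ sumP (map (λ { ((g , _) , h) → h *P g }) hs)

Disjoint : ∀ {n} → Subset n → Subset n → Set
Disjoint σ τ = ∀ i → ¬ (i ∈ σ × i ∈ τ)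

pm : ∀ {n} → Subset n → Subset n → Poly n
pm {n} σ τ = prodP (map factor (allFin n))
  where
  factor : Fin n → Poly n
  factor i = if lookup σ i then var i
             else (if lookup τ i then 1P -P var i else 1P)

IsPseudoMonomial : ∀ {n} → Poly n → Set
IsPseudoMonomial f = ∃ λ σ → ∃ λ τ → Disjoint σ τ × f ≈ pm σ τ

-- Canonical form membership: f is a minimal pseudo-monomial of the ideal
-- with membership predicate J.  The degree of pm σ τ is ∣σ∣ + ∣τ∣.
InCF : ∀ {n} → (Poly n → Set) → Poly n → Set
InCF {n} J f =
  Σ (Subset n) λ σ → Σ (Subset n) λ τ →
    Disjoint σ τ × f ≈ pm σ τ × J f ×
    ¬ (Σ (Subset n) λ σ' → Σ (Subset n) λ τ' → Σ (Poly n) λ h →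
         Disjoint σ' τ' × J (pm σ' τ') ×
         ∣ σ' ∣ + ∣ τ' ∣ < ∣ σ ∣ + ∣ τ ∣ ×
         f ≈ h *P pm σ' τ')

Code : ℕ → Set₁
Code n = Subset n → Set

ρ : ∀ {n} → Subset n → Poly n
ρ {n} v = prodP (map factor (allFin n))
  where
  factor : Fin n → Poly n
  factor i = if lookup v i then var i else 1P -P var i

NeuralIdeal : ∀ {n} → Code n → Poly n → Set
NeuralIdeal {n} C = InIdeal (λ g → ∃ λ (v : Subset n) → ¬ C v × g ≡ ρ v)

-- 𝒞_m on n = m-1 neurons (0-indexed): the prefixes {0,…,k-1}, 0 ≤ k ≤ n.
PrefixCode : (n : ℕ) → Code n
PrefixCode n v = Σ ℕ λ k → k ≤ n × (∀ (i : Fin n) → (i ∈ v ⇔ toℕ i < k))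

-- Pseudo-monomials are the indicator functions of faces of the Boolean cube: pm σ τ is the sum of
-- the ρ_w over the points w ⊇ σ avoiding τ, so it lies in the neural ideal J_C exactly when it
-- vanishes on every codeword.  For the prefix code, evaluating pm σ τ at the empty and the full
-- codeword shows σ and τ are nonempty, and evaluating at the prefix below an element j of τ
-- produces either an element of σ above j or a smaller element of τ; descending, we find i ∈ σ and
-- j ∈ τ with j < i.  Then x_i (1 - x_j) divides pm σ τ, and it lies in J_C because codewords are
-- down-closed, so minimality forces pm σ τ = x_i (1 - x_j).  Conversely every pseudo-monomial of
-- J_C has degree at least 2, which makes each x_i (1 - x_j) minimal.
--
-- Polynomials are formal lists of monomials, so they are handled up to the relation p ≃ q "every
-- parity functional agrees on p and q", which coincides with equality of coefficients but is
-- visibly a congruence.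

module Submission where

open import Defs
open import Data.Nat using (ℕ; _≤_; _∸_)
open import Data.Fin using (Fin; _<_)
open import Data.Product using (∃; _×_)
open import Function.Bundles using (_⇔_)

open import Level using (0ℓ)
open import Algebra.Bundles using (CommutativeMonoid; CommutativeRing)
import Algebra.Properties.CommutativeMonoid.Sum
open import Data.Bool using (Bool; true; false; not; _∧_; _xor_; if_then_else_)
import Data.Bool as Bool
open import Data.Bool.Properties
  using (xor-assoc; xor-same; xor-identityʳ; xor-∧-commutativeRing; not-injective; ¬-not;
         ∧-comm; ∧-zeroʳ; ∧-conicalˡ; ∧-conicalʳ)
open import Algebra.Properties.CommutativeSemigroup
  (CommutativeRing.+-commutativeSemigroup xor-∧-commutativeRing)
  using (interchange; x∙yz≈y∙xz)
open import Data.Empty using (⊥-elim)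
open import Data.Fin using (toℕ; punchIn)
import Data.Fin as Fin
import Data.Fin.Induction as Fin
import Data.Fin.Properties as Fin
open import Data.Fin.Properties using (punchInᵢ≢i; ¬∀⟶∃¬)
open import Data.Fin.Subset using (Subset; ⊥; _-_; ⁅_⁆; ∣_∣; Empty) renaming (_∈_ to _∈ₛ_)
import Data.Fin.Subset.Properties as Subset
open import Data.List using (List; []; _∷_; _++_; map; foldr; concatMap; length; cartesianProductWith)
import Data.List
import Data.List.Properties as List
open import Data.List.Membership.Propositional using (_∈_)
open import Data.List.Membership.Propositional.Properties using (∈-∃++; ∈-cartesianProductWith⁻)
import Data.List.Relation.Unary.Any as Any
open import Data.Nat as ℕ using (zero; suc; _+_; s≤s; z≤n)
import Data.Nat.Induction as ℕ
import Data.Nat.Properties as ℕ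
open import Data.Product using (Σ; _,_; proj₁; proj₂)
open import Data.Sum using (_⊎_; inj₁; inj₂; [_,_]′)
open import Data.Vec using (Vec; []; _∷_; zipWith; replicate; tabulate; lookup; here; there)
open import Data.Vec.Functional using (removeAt)
import Data.Vec.Properties as Vec
open import Data.Vec.Properties using (≡-dec; zipWith-comm; zipWith-assoc; zipWith-identityˡ)
open import Function using (_∘_; id)
open import Function.Bundles using (mk⇔; Equivalence)
open import Induction.WellFounded using (Acc; acc)
open import Relation.Binary.Bundles using (Setoid)
import Relation.Binary.Reasoning.Setoid
open import Relation.Binary.Structures using (IsEquivalence)
open import Relation.Binary.PropositionalEquality
  using (_≡_; _≢_; refl; sym; trans; cong; cong₂; subst; module ≡-Reasoning)
open import Relation.Nullary using (¬_; yes; no; contradiction)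
open import Relation.Nullary.Decidable using (⌊_⌋)

module _ {a} {A : Set a} where

  parity : (A → Bool) → List A → Bool
  parity G = foldr (λ x b → if G x then not b else b) false

  parity-∷ : ∀ G x xs → parity G (x ∷ xs) ≡ G x xor parity G xs
  parity-∷ G x xs with G x
  ... | true  = refl
  ... | false = refl

  parity-++ : ∀ G xs ys → parity G (xs ++ ys) ≡ parity G xs xor parity G ys
  parity-++ G []       ys = refl
  parity-++ G (x ∷ xs) ys = begin
    parity G (x ∷ xs ++ ys)                  ≡⟨ parity-∷ G x (xs ++ ys) ⟩
    G x xor parity G (xs ++ ys)              ≡⟨ cong (G x xor_) (parity-++ G xs ys) ⟩
    G x xor (parity G xs xor parity G ys)    ≡⟨ xor-assoc (G x) _ _ ⟨
    (G x xor parity G xs) xor parity G ys    ≡⟨ cong (_xor parity G ys) (parity-∷ G x xs) ⟨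
    parity G (x ∷ xs) xor parity G ys        ∎
    where open ≡-Reasoning

  parity-cong : ∀ {G H} → (∀ x → G x ≡ H x) → ∀ xs → parity G xs ≡ parity H xs
  parity-cong G≗H []       = refl
  parity-cong G≗H (x ∷ xs) rewrite G≗H x = cong (λ b → if _ then not b else b) (parity-cong G≗H xs)

  parity-false : ∀ xs → parity (λ _ → false) xs ≡ false
  parity-false []       = refl
  parity-false (x ∷ xs) = parity-false xs

  parity-xor : ∀ G H xs → parity (λ x → G x xor H x) xs ≡ parity G xs xor parity H xs
  parity-xor G H []       = refl
  parity-xor G H (x ∷ xs) = begin
    parity (λ x → G x xor H x) (x ∷ xs)              ≡⟨ parity-∷ _ x xs ⟩
    (G x xor H x) xor parity (λ x → G x xor H x) xs  ≡⟨ cong ((G x xor H x) xor_) (parity-xor G H xs) ⟩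
    (G x xor H x) xor (parity G xs xor parity H xs)  ≡⟨ interchange (G x) (H x) _ _ ⟩
    (G x xor parity G xs) xor (H x xor parity H xs)  ≡⟨ cong₂ _xor_ (parity-∷ G x xs) (parity-∷ H x xs) ⟨
    parity G (x ∷ xs) xor parity H (x ∷ xs)          ∎
    where open ≡-Reasoning

  parity-∧ˡ : ∀ b G xs → parity (λ x → b ∧ G x) xs ≡ b ∧ parity G xs
  parity-∧ˡ true  G xs = refl
  parity-∧ˡ false G xs = parity-false xs

  parity-pair : ∀ G x ys zs → parity G (x ∷ ys ++ x ∷ zs) ≡ parity G (ys ++ zs)
  parity-pair G x ys zs = begin
    parity G (x ∷ ys ++ x ∷ zs)
      ≡⟨ parity-∷ G x (ys ++ x ∷ zs) ⟩
    G x xor parity G (ys ++ x ∷ zs)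
      ≡⟨ cong (G x xor_) (trans (parity-++ G ys (x ∷ zs)) (cong (parity G ys xor_) (parity-∷ G x zs))) ⟩
    G x xor (parity G ys xor (G x xor parity G zs))
      ≡⟨ cong (G x xor_) (x∙yz≈y∙xz (parity G ys) (G x) (parity G zs)) ⟩
    G x xor (G x xor (parity G ys xor parity G zs))
      ≡⟨ xor-assoc (G x) (G x) _ ⟨
    (G x xor G x) xor (parity G ys xor parity G zs)
      ≡⟨ cong (_xor _) (xor-same (G x)) ⟩
    parity G ys xor parity G zs
      ≡⟨ parity-++ G ys zs ⟨
    parity G (ys ++ zs)
      ∎
    where open ≡-Reasoning

module _ {a b} {A : Set a} {B : Set b} where

  parity-map : ∀ G (f : A → B) xs → parity G (map f xs) ≡ parity (G ∘ f) xs
  parity-map G f []       = refl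
  parity-map G f (x ∷ xs) = cong (λ b → if G (f x) then not b else b) (parity-map G f xs)

  parity-concatMap : ∀ G (f : A → List B) xs →
    parity G (concatMap f xs) ≡ parity (λ x → parity G (f x)) xs
  parity-concatMap G f []       = refl
  parity-concatMap G f (x ∷ xs) = begin
    parity G (f x ++ concatMap f xs)
      ≡⟨ parity-++ G (f x) _ ⟩
    parity G (f x) xor parity G (concatMap f xs)
      ≡⟨ cong (parity G (f x) xor_) (parity-concatMap G f xs) ⟩
    parity G (f x) xor parity (λ x → parity G (f x)) xs
      ≡⟨ parity-∷ _ x xs ⟨
    parity (λ x → parity G (f x)) (x ∷ xs)
      ∎
    where open ≡-Reasoning

  parity-swap : ∀ (K : A → B → Bool) xs ys →
    parity (λ x → parity (K x) ys) xs ≡ parity (λ y → parity (λ x → K x y) xs) ys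
  parity-swap K []       ys = sym (parity-false ys)
  parity-swap K (x ∷ xs) ys = begin
    parity (λ x → parity (K x) ys) (x ∷ xs)
      ≡⟨ parity-∷ _ x xs ⟩
    parity (K x) ys xor parity (λ x → parity (K x) ys) xs
      ≡⟨ cong (parity (K x) ys xor_) (parity-swap K xs ys) ⟩
    parity (K x) ys xor parity (λ y → parity (λ x → K x y) xs) ys
      ≡⟨ parity-xor (K x) _ ys ⟨
    parity (λ y → K x y xor parity (λ x → K x y) xs) ys
      ≡⟨ parity-cong (λ y → parity-∷ (λ x → K x y) x xs) ys ⟨
    parity (λ y → parity (λ x → K x y) (x ∷ xs)) ys
      ∎
    where open ≡-Reasoning

-- Polynomials up to parity equivalence

length-++-∷ : ∀ {a} {A : Set a} (ys zs : List A) x → length (ys ++ zs) ℕ.< length (ys ++ x ∷ zs)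
length-++-∷ []       zs x = ℕ.n<1+n _
length-++-∷ (y ∷ ys) zs x = s≤s (length-++-∷ ys zs x)

xor≡false⇒≡ : ∀ x y → x xor y ≡ false → x ≡ y
xor≡false⇒≡ true  true  _ = refl
xor≡false⇒≡ false false _ = refl

module _ {n : ℕ} where

  coeff-∷-self : ∀ (α : Monomial n) p → coeff (α ∷ p) α ≡ not (coeff p α)
  coeff-∷-self α p with ≡-dec ℕ._≟_ α α
  ... | yes _  = refl
  ... | no α≢α = contradiction refl α≢α

  coeff≡true⇒∈ : ∀ (α : Monomial n) p → coeff p α ≡ true → α ∈ p
  coeff≡true⇒∈ α (β ∷ p) pα with ≡-dec ℕ._≟_ β α
  ... | yes refl = Any.here refl
  ... | no  _    = Any.there (coeff≡true⇒∈ α p pα)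

  -- As coeff r α is zero, the head α occurs again further on, and the two copies cancel.
  zero-coeffs⇒zero-parity : ∀ (r : Poly n) → Acc ℕ._<_ (length r) →
    (∀ α → coeff r α ≡ false) → ∀ G → parity G r ≡ false
  zero-coeffs⇒zero-parity []      _         _   G = refl
  zero-coeffs⇒zero-parity (α ∷ r) (acc rec) r≈0 G
    with ys , zs , refl ← ∈-∃++ (coeff≡true⇒∈ α r (not-injective (trans (sym (coeff-∷-self α r)) (r≈0 α))))
    = trans (parity-pair G α ys zs)
        (zero-coeffs⇒zero-parity (ys ++ zs) (rec (ℕ.m<n⇒m<1+n (length-++-∷ ys zs α)))
          (λ β → trans (sym (parity-pair _ α ys zs)) (r≈0 β)) G)

infix 4 _≃_
record _≃_ {n} (p q : Poly n) : Set where
  constructor mk≃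
  field parity-≡ : ∀ G → parity G p ≡ parity G q
open _≃_

module _ {n : ℕ} where

  ≈⇒≃ : {p q : Poly n} → p ≈ q → p ≃ q
  ≈⇒≃ {p} {q} p≈q = mk≃ λ G → xor≡false⇒≡ _ _ (trans (sym (parity-++ G p q))
    (zero-coeffs⇒zero-parity (p ++ q) (ℕ.<-wellFounded _) p+q≈0 G))
    where
    p+q≈0 : ∀ α → coeff (p ++ q) α ≡ false
    p+q≈0 α = trans (parity-++ _ p q) (trans (cong (_xor coeff q α) (p≈q α)) (xor-same (coeff q α)))

  -- coeff p α is the parity of the indicator function of α.
  ≃⇒≈ : {p q : Poly n} → p ≃ q → p ≈ q
  ≃⇒≈ p≃q α = parity-≡ p≃q _

  ≃-refl : {p : Poly n} → p ≃ p
  ≃-refl = mk≃ λ G → refl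

  ≃-sym : {p q : Poly n} → p ≃ q → q ≃ p
  ≃-sym p≃q = mk≃ λ G → sym (parity-≡ p≃q G)

  ≃-trans : {p q r : Poly n} → p ≃ q → q ≃ r → p ≃ r
  ≃-trans p≃q q≃r = mk≃ λ G → trans (parity-≡ p≃q G) (parity-≡ q≃r G)

  ≡⇒≃ : {p q : Poly n} → p ≡ q → p ≃ q
  ≡⇒≃ refl = ≃-refl

  ≃-isEquivalence : IsEquivalence (_≃_ {n})
  ≃-isEquivalence = record { refl = ≃-refl ; sym = ≃-sym ; trans = ≃-trans }

  ≃-setoid : Setoid 0ℓ 0ℓ
  ≃-setoid = record { isEquivalence = ≃-isEquivalence }

  module ≃-Reasoning = Relation.Binary.Reasoning.Setoid ≃-setoid

  parity-* : ∀ G (p q : Poly n) →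
    parity G (p *P q) ≡ parity (λ α → parity (λ β → G (zipWith _+_ α β)) q) p
  parity-* G p q = trans (parity-concatMap G _ p) (parity-cong (λ α → parity-map G _ q) p)

  +-cong : {p p′ q q′ : Poly n} → p ≃ p′ → q ≃ q′ → p +P q ≃ p′ +P q′
  +-cong {p} {p′} {q} {q′} p≃p′ q≃q′ = mk≃ λ G → begin
    parity G (p ++ q)            ≡⟨ parity-++ G p q ⟩
    parity G p xor parity G q    ≡⟨ cong₂ _xor_ (parity-≡ p≃p′ G) (parity-≡ q≃q′ G) ⟩
    parity G p′ xor parity G q′  ≡⟨ parity-++ G p′ q′ ⟨
    parity G (p′ ++ q′)          ∎
    where open ≡-Reasoning

  *-cong : {p p′ q q′ : Poly n} → p ≃ p′ → q ≃ q′ → p *P q ≃ p′ *P q′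
  *-cong {p} {p′} {q} {q′} p≃p′ q≃q′ = mk≃ λ G → begin
    parity G (p *P q)                                        ≡⟨ parity-* G p q ⟩
    parity (λ α → parity (λ β → G (zipWith _+_ α β)) q) p    ≡⟨ parity-cong (λ α → parity-≡ q≃q′ _) p ⟩
    parity (λ α → parity (λ β → G (zipWith _+_ α β)) q′) p   ≡⟨ parity-≡ p≃p′ _ ⟩
    parity (λ α → parity (λ β → G (zipWith _+_ α β)) q′) p′  ≡⟨ parity-* G p′ q′ ⟨
    parity G (p′ *P q′)                                      ∎
    where open ≡-Reasoning

  *-comm : ∀ (p q : Poly n) → p *P q ≃ q *P p
  *-comm p q = mk≃ λ G → begin
    parity G (p *P q)
      ≡⟨ parity-* G p q ⟩
    parity (λ α → parity (λ β → G (zipWith _+_ α β)) q) p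
      ≡⟨ parity-swap _ p q ⟩
    parity (λ β → parity (λ α → G (zipWith _+_ α β)) p) q
      ≡⟨ parity-cong (λ β → parity-cong (λ α → cong G (zipWith-comm ℕ.+-comm α β)) p) q ⟩
    parity (λ β → parity (λ α → G (zipWith _+_ β α)) p) q
      ≡⟨ parity-* G q p ⟨
    parity G (q *P p)
      ∎
    where open ≡-Reasoning

  *-assoc : ∀ (p q r : Poly n) → (p *P q) *P r ≃ p *P (q *P r)
  *-assoc p q r = mk≃ λ G → begin
    parity G ((p *P q) *P r)
      ≡⟨ trans (parity-* G (p *P q) r) (parity-* _ p q) ⟩
    parity (λ α → parity (λ β → parity (λ γ → G (zipWith _+_ (zipWith _+_ α β) γ)) r) q) p
      ≡⟨ parity-cong (λ α → parity-cong (λ β → parity-cong (λ γ →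
           cong G (zipWith-assoc ℕ.+-assoc α β γ)) r) q) p ⟩
    parity (λ α → parity (λ β → parity (λ γ → G (zipWith _+_ α (zipWith _+_ β γ))) r) q) p
      ≡⟨ parity-cong (λ α → parity-* _ q r) p ⟨
    parity (λ α → parity (λ δ → G (zipWith _+_ α δ)) (q *P r)) p
      ≡⟨ parity-* G p (q *P r) ⟨
    parity G (p *P (q *P r))
      ∎
    where open ≡-Reasoning

  *-identityˡ : ∀ (p : Poly n) → 1P *P p ≃ p
  *-identityˡ p = mk≃ λ G → begin
    parity G (1P *P p)
      ≡⟨ parity-* G 1P p ⟩
    parity (λ α → parity (λ β → G (zipWith _+_ α β)) p) 1P
      ≡⟨ parity-∷ (λ α → parity (λ β → G (zipWith _+_ α β)) p) 0# [] ⟩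
    parity (λ β → G (zipWith _+_ 0# β)) p xor false
      ≡⟨ xor-identityʳ _ ⟩
    parity (λ β → G (zipWith _+_ 0# β)) p
      ≡⟨ parity-cong (λ β → cong G (zipWith-identityˡ ℕ.+-identityˡ β)) p ⟩
    parity G p
      ∎
    where
    open ≡-Reasoning
    0# : Monomial n
    0# = replicate n 0

  *-identityʳ : ∀ (p : Poly n) → p *P 1P ≃ p
  *-identityʳ p = ≃-trans (*-comm p 1P) (*-identityˡ p)

  *-distribʳ : ∀ (p q r : Poly n) → (p +P q) *P r ≃ p *P r +P q *P r
  *-distribʳ p q r = ≡⇒≃ (List.concatMap-++ _ p q)

  *-distribˡ : ∀ (p q r : Poly n) → p *P (q +P r) ≃ p *P q +P p *P r
  *-distribˡ p q r = begin
    p *P (q +P r)     ≈⟨ *-comm p (q +P r) ⟩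
    (q +P r) *P p     ≈⟨ *-distribʳ q r p ⟩
    q *P p +P r *P p  ≈⟨ +-cong (*-comm q p) (*-comm r p) ⟩
    p *P q +P p *P r  ∎
    where open ≃-Reasoning

  *-zeroʳ : ∀ (p : Poly n) → p *P 0P ≃ 0P
  *-zeroʳ p = mk≃ λ G → trans (parity-* G p 0P) (parity-false p)

  1≃x+[1-x] : ∀ (x : Poly n) → 1P ≃ x +P (1P -P x)
  1≃x+[1-x] x = mk≃ λ G → sym (begin
    parity G (x ++ (1P ++ x))                     ≡⟨ parity-++ G x (1P ++ x) ⟩
    parity G x xor parity G (1P ++ x)             ≡⟨ cong (parity G x xor_) (parity-++ G 1P x) ⟩
    parity G x xor (parity G 1P xor parity G x)   ≡⟨ x∙yz≈y∙xz (parity G x) (parity G 1P) _ ⟩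
    parity G 1P xor (parity G x xor parity G x)   ≡⟨ cong (parity G 1P xor_) (xor-same (parity G x)) ⟩
    parity G 1P xor false                         ≡⟨ xor-identityʳ _ ⟩
    parity G 1P                                   ∎)
    where open ≡-Reasoning

*-commutativeMonoid : ℕ → CommutativeMonoid 0ℓ 0ℓ
*-commutativeMonoid n = record
  { Carrier = Poly n
  ; _≈_ = _≃_
  ; _∙_ = _*P_
  ; ε = 1P
  ; isCommutativeMonoid = record
    { isMonoid = record
      { isSemigroup = record
        { isMagma = record { isEquivalence = ≃-isEquivalence ; ∙-cong = *-cong }
        ; assoc = *-assoc
        }
      ; identity = *-identityˡ , *-identityʳ
      }
    ; comm = *-comm
    }
  }

module ∏-Properties (n : ℕ) = Algebra.Properties.CommutativeMonoid.Sum (*-commutativeMonoid n)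

∏ : ∀ {n d} → (Fin d → Poly n) → Poly n
∏ {n} = ∏-Properties.sum n

prodP-tabulate : ∀ {n d} (F : Fin d → Poly n) → prodP (Data.List.tabulate F) ≡ ∏ F
prodP-tabulate {d = zero}  F = refl
prodP-tabulate {d = suc d} F = cong (F Fin.zero *P_) (prodP-tabulate (F ∘ Fin.suc))

module _ {n : ℕ} {A : Set} where

  sumOver : (A → Poly n) → List A → Poly n
  sumOver f xs = sumP (map f xs)

  sumOver-cong : ∀ {f g : A → Poly n} → (∀ x → f x ≃ g x) → ∀ xs → sumOver f xs ≃ sumOver g xs
  sumOver-cong f≃g []       = ≃-refl
  sumOver-cong f≃g (x ∷ xs) = +-cong (f≃g x) (sumOver-cong f≃g xs)

  sumOver-++ : ∀ (f : A → Poly n) xs ys → sumOver f (xs ++ ys) ≡ sumOver f xs +P sumOver f ys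
  sumOver-++ f []       ys = refl
  sumOver-++ f (x ∷ xs) ys = trans (cong (f x ++_) (sumOver-++ f xs ys)) (sym (List.++-assoc (f x) _ _))

  sumOver-*ˡ : ∀ (p : Poly n) f xs → p *P sumOver f xs ≃ sumOver (λ x → p *P f x) xs
  sumOver-*ˡ p f []       = *-zeroʳ p
  sumOver-*ˡ p f (x ∷ xs) =
    ≃-trans (*-distribˡ p (f x) (sumOver f xs)) (+-cong (≃-refl {p = p *P f x}) (sumOver-*ˡ p f xs))

sumOver-map : ∀ {n} {A B : Set} (f : B → Poly n) (h : A → B) xs →
  sumOver f (map h xs) ≡ sumOver (f ∘ h) xs
sumOver-map f h xs = cong sumP (sym (List.map-∘ xs))

sumOver-*-sumOver : ∀ {n} {A B C : Set} (f : A → Poly n) (g : B → Poly n) (F : C → Poly n)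
  (h : A → B → C) → (∀ x y → F (h x y) ≃ f x *P g y) →
  ∀ xs ys → sumOver f xs *P sumOver g ys ≃ sumOver F (cartesianProductWith h xs ys)
sumOver-*-sumOver f g F h F∘h≃ []       ys = ≃-refl
sumOver-*-sumOver f g F h F∘h≃ (x ∷ xs) ys = begin
  (f x +P sumOver f xs) *P sumOver g ys
    ≈⟨ *-distribʳ (f x) (sumOver f xs) (sumOver g ys) ⟩
  f x *P sumOver g ys +P sumOver f xs *P sumOver g ys
    ≈⟨ +-cong (sumOver-*ˡ (f x) g ys) (sumOver-*-sumOver f g F h F∘h≃ xs ys) ⟩
  sumOver (λ y → f x *P g y) ys +P sumOver F (cartesianProductWith h xs ys)
    ≈⟨ +-cong (sumOver-cong (λ y → ≃-sym (F∘h≃ x y)) ys) ≃-refl ⟩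
  sumOver (F ∘ h x) ys +P sumOver F (cartesianProductWith h xs ys)
    ≡⟨ cong (_+P sumOver F (cartesianProductWith h xs ys)) (sumOver-map F (h x) ys) ⟨
  sumOver F (map (h x) ys) +P sumOver F (cartesianProductWith h xs ys)
    ≡⟨ sumOver-++ F (map (h x) ys) _ ⟨
  sumOver F (cartesianProductWith h (x ∷ xs) ys)
    ∎
  where open ≃-Reasoning

choiceVectors : ∀ {d} {A : Set} → (Fin d → List A) → List (Vec A d)
choiceVectors {zero}  L = [] ∷ []
choiceVectors {suc d} L = cartesianProductWith _∷_ (L Fin.zero) (choiceVectors (L ∘ Fin.suc))

∈-choiceVectors : ∀ {d} {A : Set} (L : Fin d → List A) {w} →
  w ∈ choiceVectors L → ∀ k → lookup w k ∈ L k
∈-choiceVectors {suc d} L w∈ k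
  with a , w′ , a∈ , w′∈ , refl ←
    ∈-cartesianProductWith⁻ _∷_ (L Fin.zero) (choiceVectors (L ∘ Fin.suc)) w∈
  with k
... | Fin.zero  = a∈
... | Fin.suc k = ∈-choiceVectors (L ∘ Fin.suc) w′∈ k

∏-sumOver : ∀ {n d} {A : Set} (L : Fin d → List A) (g : Fin d → A → Poly n) →
  ∏ (λ k → sumOver (g k) (L k)) ≃ sumOver (λ w → ∏ (λ k → g k (lookup w k))) (choiceVectors L)
∏-sumOver {d = zero}  L g = ≡⇒≃ (sym (List.++-identityʳ 1P))
∏-sumOver {d = suc d} L g =
  ≃-trans (*-cong (≃-refl {p = sumOver (g Fin.zero) (L Fin.zero)}) (∏-sumOver (L ∘ Fin.suc) (g ∘ Fin.suc)))
    (sumOver-*-sumOver (g Fin.zero) _ _ _∷_ (λ _ _ → ≃-refl) (L Fin.zero) _)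

-- Evaluation at Boolean points

evalMonomial : ∀ {n} → Vec Bool n → Monomial n → Bool
evalMonomial []          []          = true
evalMonomial (true ∷ c)  (_ ∷ α)     = evalMonomial c α
evalMonomial (false ∷ c) (zero ∷ α)  = evalMonomial c α
evalMonomial (false ∷ c) (suc _ ∷ α) = false

evalMonomial-0∷ : ∀ {n} b (c : Vec Bool n) α → evalMonomial (b ∷ c) (0 ∷ α) ≡ evalMonomial c α
evalMonomial-0∷ true  c α = refl
evalMonomial-0∷ false c α = refl

evalMonomial-0 : ∀ {n} (c : Vec Bool n) α → (∀ j → lookup α j ≡ 0) → evalMonomial c α ≡ true
evalMonomial-0 []      []      α≗0 = refl
evalMonomial-0 (b ∷ c) (a ∷ α) α≗0 rewrite α≗0 Fin.zero =
  trans (evalMonomial-0∷ b c α) (evalMonomial-0 c α (α≗0 ∘ Fin.suc))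

evalMonomial-unit : ∀ {n} (c : Vec Bool n) i →
  evalMonomial c (tabulate (λ j → if ⌊ i Fin.≟ j ⌋ then 1 else 0)) ≡ lookup c i
evalMonomial-unit (true ∷ c)  Fin.zero    = evalMonomial-0 c _ (Vec.lookup∘tabulate _)
evalMonomial-unit (false ∷ c) Fin.zero    = refl
evalMonomial-unit (b ∷ c)     (Fin.suc i) =
  trans (evalMonomial-0∷ b c _)
    (trans (cong (evalMonomial c) (Vec.tabulate-cong suc≟suc)) (evalMonomial-unit c i))
  where
  suc≟suc : ∀ j → (if ⌊ Fin.suc i Fin.≟ Fin.suc j ⌋ then 1 else 0) ≡
                  (if ⌊ i Fin.≟ j ⌋ then 1 else 0)
  suc≟suc j with i Fin.≟ j
  ... | yes _ = refl
  ... | no  _ = refl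

evalMonomial-+ : ∀ {n} (c : Vec Bool n) α β →
  evalMonomial c (zipWith _+_ α β) ≡ evalMonomial c α ∧ evalMonomial c β
evalMonomial-+ []          []          []          = refl
evalMonomial-+ (true ∷ c)  (_ ∷ α)     (_ ∷ β)     = evalMonomial-+ c α β
evalMonomial-+ (false ∷ c) (zero ∷ α)  (zero ∷ β)  = evalMonomial-+ c α β
evalMonomial-+ (false ∷ c) (zero ∷ α)  (suc _ ∷ β) = sym (∧-zeroʳ _)
evalMonomial-+ (false ∷ c) (suc _ ∷ α) (_ ∷ β)     = refl

module _ {n : ℕ} (c : Vec Bool n) where

  eval : Poly n → Bool
  eval = parity (evalMonomial c)

  eval-≃ : {p q : Poly n} → p ≃ q → eval p ≡ eval q
  eval-≃ p≃q = parity-≡ p≃q (evalMonomial c)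

  eval-+P : ∀ p q → eval (p +P q) ≡ eval p xor eval q
  eval-+P = parity-++ (evalMonomial c)

  eval-*P : ∀ p q → eval (p *P q) ≡ eval p ∧ eval q
  eval-*P p q = begin
    eval (p *P q)
      ≡⟨ parity-* _ p q ⟩
    parity (λ α → parity (λ β → evalMonomial c (zipWith _+_ α β)) q) p
      ≡⟨ parity-cong (λ α → parity-cong (evalMonomial-+ c α) q) p ⟩
    parity (λ α → parity (λ β → evalMonomial c α ∧ evalMonomial c β) q) p
      ≡⟨ parity-cong (λ α → trans (parity-∧ˡ (evalMonomial c α) _ q) (∧-comm _ (eval q))) p ⟩
    parity (λ α → eval q ∧ evalMonomial c α) p
      ≡⟨ trans (parity-∧ˡ (eval q) _ p) (∧-comm (eval q) (eval p)) ⟩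
    eval p ∧ eval q
      ∎
    where open ≡-Reasoning

  eval-1P : eval 1P ≡ true
  eval-1P rewrite evalMonomial-0 c (replicate n 0) (λ j → Vec.lookup-replicate j 0) = refl

  eval-var : ∀ i → eval (var i) ≡ lookup c i
  eval-var i = trans (parity-∷ (evalMonomial c) _ []) (trans (xor-identityʳ _) (evalMonomial-unit c i))

  eval-1-var : ∀ i → eval (1P -P var i) ≡ not (lookup c i)
  eval-1-var i = trans (eval-+P 1P (var i)) (cong₂ _xor_ eval-1P (eval-var i))

  eval-∏ : ∀ {d} (F : Fin d → Poly n) → eval (∏ F) ≡ true ⇔ (∀ k → eval (F k) ≡ true)
  eval-∏ {zero}  F = mk⇔ (λ _ ()) (λ _ → eval-1P)
  eval-∏ {suc d} F = mk⇔
    (λ ∏F≡true → λ where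
      Fin.zero    → ∧-conicalˡ (eval (F Fin.zero)) (eval (∏ (F ∘ Fin.suc))) (head∧tail≡true ∏F≡true)
      (Fin.suc k) → Equivalence.to (eval-∏ (F ∘ Fin.suc))
                      (∧-conicalʳ (eval (F Fin.zero)) _ (head∧tail≡true ∏F≡true)) k)
    (λ all-true → trans (eval-*P (F Fin.zero) (∏ (F ∘ Fin.suc)))
      (cong₂ _∧_ (all-true Fin.zero) (Equivalence.from (eval-∏ (F ∘ Fin.suc)) (all-true ∘ Fin.suc))))
    where
    head∧tail≡true : eval (∏ F) ≡ true → eval (F Fin.zero) ∧ eval (∏ (F ∘ Fin.suc)) ≡ true
    head∧tail≡true = trans (sym (eval-*P (F Fin.zero) (∏ (F ∘ Fin.suc))))

module _ {n : ℕ} where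

  literal : Bool → Fin n → Poly n
  literal b k = if b then var k else 1P -P var k

  pmFactor : Bool → Bool → Fin n → Poly n
  pmFactor s t k = if s then var k else (if t then 1P -P var k else 1P)

  pm≡∏ : ∀ σ τ → pm σ τ ≡ ∏ (λ k → pmFactor (lookup σ k) (lookup τ k) k)
  pm≡∏ σ τ = trans (cong prodP (List.map-tabulate id F)) (prodP-tabulate F)
    where
    F : Fin n → Poly n
    F k = pmFactor (lookup σ k) (lookup τ k) k

  ρ≡∏ : ∀ v → ρ v ≡ ∏ (λ k → literal (lookup v k) k)
  ρ≡∏ v = trans (cong prodP (List.map-tabulate id F)) (prodP-tabulate F)
    where
    F : Fin n → Poly n
    F k = literal (lookup v k) k

  pm-⊥ : pm ⊥ ⊥ ≃ 1P
  pm-⊥ = begin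
    pm ⊥ ⊥                                          ≡⟨ pm≡∏ ⊥ ⊥ ⟩
    ∏ (λ k → pmFactor (lookup ⊥ k) (lookup ⊥ k) k)  ≡⟨ ∏-Properties.sum-cong-≗ n ⊥-factor≡1 ⟩
    ∏ {d = n} (λ _ → 1P)                            ≈⟨ ∏-Properties.sum-replicate-zero n n ⟩
    1P                                              ∎
    where
    open ≃-Reasoning
    ⊥-factor≡1 : ∀ k → pmFactor (lookup ⊥ k) (lookup ⊥ k) k ≡ 1P
    ⊥-factor≡1 k = cong (λ b → pmFactor b b k) (Vec.lookup-replicate k false)

lookup-remove-self : ∀ {n} (p : Subset n) i → lookup (p - i) i ≡ false
lookup-remove-self (x ∷ p) Fin.zero    = refl
lookup-remove-self (x ∷ p) (Fin.suc i) = lookup-remove-self p i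

lookup-remove-other : ∀ {n} (p : Subset n) {i k} → k ≢ i → lookup (p - i) k ≡ lookup p k
lookup-remove-other (x ∷ p) {Fin.zero}  {Fin.zero}  k≢i = contradiction refl k≢i
lookup-remove-other (x ∷ p) {Fin.zero}  {Fin.suc k} k≢i = cong (λ q → lookup q k) (Subset.p─⊥≡p p)
lookup-remove-other (x ∷ p) {Fin.suc i} {Fin.zero}  k≢i = refl
lookup-remove-other (x ∷ p) {Fin.suc i} {Fin.suc k} k≢i = lookup-remove-other p (k≢i ∘ cong Fin.suc)

pm-extract : ∀ {n} (σ τ : Subset n) i →
  pm σ τ ≃ pmFactor (lookup σ i) (lookup τ i) i *P pm (σ - i) (τ - i)
pm-extract {suc n} σ τ i = begin
  pm σ τ                     ≡⟨ pm≡∏ σ τ ⟩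
  ∏ F                        ≈⟨ ∏-Properties.sum-remove (suc n) {i = i} F ⟩
  F i *P ∏ (removeAt F i)    ≡⟨ cong (F i *P_) (∏-Properties.sum-cong-≗ (suc n) F′≗F) ⟨
  F i *P ∏ (removeAt F′ i)   ≈⟨ *-cong (≃-refl {p = F i}) pm-removed ⟨
  F i *P pm (σ - i) (τ - i)  ∎
  where
  open ≃-Reasoning
  F F′ : Fin (suc n) → Poly (suc n)
  F  k = pmFactor (lookup σ k) (lookup τ k) k
  F′ k = pmFactor (lookup (σ - i) k) (lookup (τ - i) k) k
  F′≗F : ∀ k → removeAt F′ i k ≡ removeAt F i k
  F′≗F k = cong₂ (λ s t → pmFactor s t (punchIn i k))
    (lookup-remove-other σ (punchInᵢ≢i i k)) (lookup-remove-other τ (punchInᵢ≢i i k))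
  pm-removed : pm (σ - i) (τ - i) ≃ ∏ (removeAt F′ i)
  pm-removed = begin
    pm (σ - i) (τ - i)         ≡⟨ pm≡∏ (σ - i) (τ - i) ⟩
    ∏ F′                       ≈⟨ ∏-Properties.sum-remove (suc n) {i = i} F′ ⟩
    F′ i *P ∏ (removeAt F′ i)  ≡⟨ cong₂ (λ s t → pmFactor s t i *P ∏ (removeAt F′ i))
                                    (lookup-remove-self σ i) (lookup-remove-self τ i) ⟩
    1P *P ∏ (removeAt F′ i)    ≈⟨ *-identityˡ (∏ (removeAt F′ i)) ⟩
    ∏ (removeAt F′ i)          ∎

∈⇒1≤∣∣ : ∀ {n} {p : Subset n} {x} → x ∈ₛ p → 1 ≤ ∣ p ∣
∈⇒1≤∣∣ x∈p = ℕ.≤-trans (s≤s z≤n) (Subset.x∈p⇒∣p-x∣<∣p∣ x∈p)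

∈-remove⇒2≤∣∣ : ∀ {n} {p : Subset n} {x y} → y ∈ₛ p → x ∈ₛ p - y → 2 ≤ ∣ p ∣
∈-remove⇒2≤∣∣ y∈p x∈p-y = ℕ.≤-trans (s≤s (∈⇒1≤∣∣ x∈p-y)) (Subset.x∈p⇒∣p-x∣<∣p∣ y∈p)

module _ {n : ℕ} {σ τ : Subset n} {i j : Fin n}
         (σ∩τ=∅ : Disjoint σ τ) (i∈σ : i ∈ₛ σ) (j∈τ : j ∈ₛ τ) where

  disjoint-∈⇒≢ : i ≢ j
  disjoint-∈⇒≢ refl = σ∩τ=∅ i (i∈σ , j∈τ)

  pm-peel : pm σ τ ≃ (var i *P (1P -P var j)) *P pm (σ - i - j) (τ - i - j)
  pm-peel = begin
    pm σ τ
      ≈⟨ pm-extract σ τ i ⟩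
    pmFactor (lookup σ i) (lookup τ i) i *P pm (σ - i) (τ - i)
      ≡⟨ cong (λ s → pmFactor s (lookup τ i) i *P pm (σ - i) (τ - i)) (Vec.[]=⇒lookup i∈σ) ⟩
    var i *P pm (σ - i) (τ - i)
      ≈⟨ *-cong (≃-refl {p = var i}) (pm-extract (σ - i) (τ - i) j) ⟩
    var i *P (pmFactor (lookup (σ - i) j) (lookup (τ - i) j) j *P h)
      ≡⟨ cong₂ (λ s t → var i *P (pmFactor s t j *P h)) j∉σ-i j∈τ-i ⟩
    var i *P ((1P -P var j) *P h)
      ≈⟨ *-assoc (var i) (1P -P var j) h ⟨
    (var i *P (1P -P var j)) *P h
      ∎
    where
    open ≃-Reasoning
    h : Poly n
    h = pm (σ - i - j) (τ - i - j)
    j≢i : j ≢ i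
    j≢i = disjoint-∈⇒≢ ∘ sym
    j∉σ-i : lookup (σ - i) j ≡ false
    j∉σ-i = trans (lookup-remove-other σ j≢i) (¬-not λ σj → σ∩τ=∅ j (Vec.lookup⇒[]= j σ σj , j∈τ))
    j∈τ-i : lookup (τ - i) j ≡ true
    j∈τ-i = trans (lookup-remove-other τ j≢i) (Vec.[]=⇒lookup j∈τ)

  peeled-empty : ∣ σ ∣ + ∣ τ ∣ ≤ 2 → σ - i - j ≡ ⊥ × τ - i - j ≡ ⊥
  peeled-empty deg≤2 = Subset.Empty-unique σ-i-j-empty , Subset.Empty-unique τ-i-j-empty
    where
    σ-i-j-empty : Empty (σ - i - j)
    σ-i-j-empty (k , k∈σ-i-j) = ℕ.≤⇒≯ deg≤2
      (ℕ.+-mono-≤ (∈-remove⇒2≤∣∣ i∈σ (Subset.p─q⊆p (σ - i) ⁅ j ⁆ k∈σ-i-j)) (∈⇒1≤∣∣ j∈τ))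
    τ-i-j-empty : Empty (τ - i - j)
    τ-i-j-empty (k , k∈τ-i-j) rewrite Subset.p─x─y≡p─y─x τ i j = ℕ.≤⇒≯ deg≤2
      (ℕ.+-mono-≤ (∈⇒1≤∣∣ i∈σ) (∈-remove⇒2≤∣∣ j∈τ (Subset.p─q⊆p (τ - j) ⁅ i ⁆ k∈τ-i-j)))

  pm-degree-two : ∣ σ ∣ + ∣ τ ∣ ≤ 2 → pm σ τ ≃ var i *P (1P -P var j)
  pm-degree-two deg≤2 = begin
    pm σ τ                     ≈⟨ pm-peel ⟩
    x[1-x] *P pm (σ - i - j) (τ - i - j)
      ≡⟨ cong₂ (λ σ′ τ′ → x[1-x] *P pm σ′ τ′) (proj₁ (peeled-empty deg≤2)) (proj₂ (peeled-empty deg≤2)) ⟩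
    x[1-x] *P pm ⊥ ⊥           ≈⟨ *-cong (≃-refl {p = x[1-x]}) pm-⊥ ⟩
    x[1-x] *P 1P               ≈⟨ *-identityʳ x[1-x] ⟩
    x[1-x]                     ∎
    where
    open ≃-Reasoning
    x[1-x] : Poly n
    x[1-x] = var i *P (1P -P var j)

module _ {n : ℕ} {i j : Fin n} (i≢j : i ≢ j) where

  singletons-disjoint : Disjoint ⁅ i ⁆ ⁅ j ⁆
  singletons-disjoint k (k∈⁅i⁆ , k∈⁅j⁆) =
    i≢j (trans (sym (Subset.x∈⁅y⁆⇒x≡y i k∈⁅i⁆)) (Subset.x∈⁅y⁆⇒x≡y j k∈⁅j⁆))

  ∣⁅i⁆∣+∣⁅j⁆∣≡2 : ∣ ⁅ i ⁆ ∣ + ∣ ⁅ j ⁆ ∣ ≡ 2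
  ∣⁅i⁆∣+∣⁅j⁆∣≡2 = cong₂ _+_ (Subset.∣⁅x⁆∣≡1 i) (Subset.∣⁅x⁆∣≡1 j)

  pm-singletons : pm ⁅ i ⁆ ⁅ j ⁆ ≃ var i *P (1P -P var j)
  pm-singletons =
    pm-degree-two singletons-disjoint (Subset.x∈⁅x⁆ i) (Subset.x∈⁅x⁆ j) (ℕ.≤-reflexive ∣⁅i⁆∣+∣⁅j⁆∣≡2)

module _ {n : ℕ} {σ τ : Subset n} {i j : Fin n}
         (σ∩τ=∅ : Disjoint σ τ) (i∈σ : i ∈ₛ σ) (j∈τ : j ∈ₛ τ) where

  pm-degree-two-or-divisible :
    pm σ τ ≃ var i *P (1P -P var j) ⊎
    (∣ ⁅ i ⁆ ∣ + ∣ ⁅ j ⁆ ∣ ℕ.< ∣ σ ∣ + ∣ τ ∣ × pm σ τ ≃ pm (σ - i - j) (τ - i - j) *P pm ⁅ i ⁆ ⁅ j ⁆)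
  pm-degree-two-or-divisible with ∣ σ ∣ + ∣ τ ∣ ℕ.≤? 2
  ... | yes deg≤2 = inj₁ (pm-degree-two σ∩τ=∅ i∈σ j∈τ deg≤2)
  ... | no  deg≰2 = inj₂ (subst (ℕ._< ∣ σ ∣ + ∣ τ ∣) (sym (∣⁅i⁆∣+∣⁅j⁆∣≡2 distinct)) (ℕ.≰⇒> deg≰2) , pm≃h*pm)
    where
    open ≃-Reasoning
    distinct : i ≢ j
    distinct = disjoint-∈⇒≢ σ∩τ=∅ i∈σ j∈τ
    h : Poly n
    h = pm (σ - i - j) (τ - i - j)
    pm≃h*pm : pm σ τ ≃ h *P pm ⁅ i ⁆ ⁅ j ⁆
    pm≃h*pm = begin
      pm σ τ                         ≈⟨ pm-peel σ∩τ=∅ i∈σ j∈τ ⟩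
      (var i *P (1P -P var j)) *P h  ≈⟨ *-comm (var i *P (1P -P var j)) h ⟩
      h *P (var i *P (1P -P var j))  ≈⟨ *-cong (≃-refl {p = h}) (pm-singletons distinct) ⟨
      h *P pm ⁅ i ⁆ ⁅ j ⁆            ∎

-- Pseudo-monomials as sums of the ρ_w

factorSupport : Bool → Bool → List Bool
factorSupport true  _     = true ∷ []
factorSupport false true  = false ∷ []
factorSupport false false = true ∷ false ∷ []

support : ∀ {n} → Subset n → Subset n → List (Subset n)
support σ τ = choiceVectors (λ k → factorSupport (lookup σ k) (lookup τ k))

module _ {n : ℕ} where

  pmFactor-expansion : ∀ s t (k : Fin n) → pmFactor s t k ≃ sumOver (λ b → literal b k) (factorSupport s t)
  pmFactor-expansion true  t     k = ≡⇒≃ (sym (List.++-identityʳ (var k)))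
  pmFactor-expansion false true  k = ≡⇒≃ (sym (List.++-identityʳ (1P -P var k)))
  pmFactor-expansion false false k =
    ≃-trans (1≃x+[1-x] (var k))
      (+-cong (≃-refl {p = var k}) (≡⇒≃ (sym (List.++-identityʳ (1P -P var k)))))

  pm-expansion : ∀ (σ τ : Subset n) → pm σ τ ≃ sumOver ρ (support σ τ)
  pm-expansion σ τ = begin
    pm σ τ
      ≡⟨ pm≡∏ σ τ ⟩
    ∏ (λ k → pmFactor (lookup σ k) (lookup τ k) k)
      ≈⟨ ∏-Properties.sum-cong-≋ n (λ k → pmFactor-expansion (lookup σ k) (lookup τ k) k) ⟩
    ∏ (λ k → sumOver (λ b → literal b k) (factorSupport (lookup σ k) (lookup τ k)))
      ≈⟨ ∏-sumOver (λ k → factorSupport (lookup σ k) (lookup τ k)) (λ k b → literal b k) ⟩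
    sumOver (λ w → ∏ (λ k → literal (lookup w k) k)) (support σ τ)
      ≈⟨ sumOver-cong (λ w → ≡⇒≃ (ρ≡∏ w)) (support σ τ) ⟨
    sumOver ρ (support σ τ)
      ∎
    where open ≃-Reasoning

lookup≡false⇒∉ : ∀ {n} {p : Subset n} {k} → lookup p k ≡ false → ¬ (k ∈ₛ p)
lookup≡false⇒∉ pk≡false k∈p with () ← trans (sym (Vec.[]=⇒lookup k∈p)) pk≡false

-- The combinatorial form of eval c (pm σ τ) ≡ false.
Excludes : ∀ {n} → Subset n → Subset n → Subset n → Set
Excludes σ τ c = ∃ λ k → (k ∈ₛ σ × ¬ (k ∈ₛ c)) ⊎ (k ∈ₛ τ × k ∈ₛ c)

module _ {n : ℕ} (c : Subset n) where

  eval-literal : ∀ b k → eval c (literal b k) ≡ true → b ≡ lookup c k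
  eval-literal true  k ≡true = trans (sym ≡true) (eval-var c k)
  eval-literal false k ≡true = sym (not-injective (trans (sym (eval-1-var c k)) ≡true))

  eval-ρ : ∀ v → eval c (ρ v) ≡ true → v ≡ c
  eval-ρ v ρv≡true = begin
    v                    ≡⟨ Vec.tabulate∘lookup v ⟨
    tabulate (lookup v)  ≡⟨ Vec.tabulate-cong (λ k → eval-literal (lookup v k) k (literals-true k)) ⟩
    tabulate (lookup c)  ≡⟨ Vec.tabulate∘lookup c ⟩
    c                    ∎
    where
    open ≡-Reasoning
    literals-true : ∀ k → eval c (literal (lookup v k) k) ≡ true
    literals-true = Equivalence.to (eval-∏ c (λ k → literal (lookup v k) k))
      (trans (cong (eval c) (sym (ρ≡∏ v))) ρv≡true)

  eval-pmFactor-support : ∀ s t k → lookup c k ∈ factorSupport s t → eval c (pmFactor s t k) ≡ true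
  eval-pmFactor-support true  t     k (Any.here ck≡true)  = trans (eval-var c k) ck≡true
  eval-pmFactor-support false true  k (Any.here ck≡false) = trans (eval-1-var c k) (cong not ck≡false)
  eval-pmFactor-support false false k _                   = eval-1P c

  eval-support : ∀ σ τ → c ∈ support σ τ → eval c (pm σ τ) ≡ true
  eval-support σ τ c∈ = trans (cong (eval c) (pm≡∏ σ τ))
    (Equivalence.from (eval-∏ c (λ k → pmFactor (lookup σ k) (lookup τ k) k)) λ k →
      eval-pmFactor-support (lookup σ k) (lookup τ k) k (∈-choiceVectors _ c∈ k))

  eval-pmFactor≢true : ∀ s t k → eval c (pmFactor s t k) ≢ true →
    (s ≡ true × lookup c k ≡ false) ⊎ (t ≡ true × lookup c k ≡ true)
  eval-pmFactor≢true true  t     k ≢true = inj₁ (refl , ¬-not (≢true ∘ trans (eval-var c k)))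
  eval-pmFactor≢true false true  k ≢true = inj₂ (refl , not-injective (¬-not (≢true ∘ trans (eval-1-var c k))))
  eval-pmFactor≢true false false k ≢true = contradiction (eval-1P c) ≢true

  eval-pm≡false⇒excludes : ∀ σ τ → eval c (pm σ τ) ≡ false → Excludes σ τ c
  eval-pm≡false⇒excludes σ τ pm≡false =
    excludes (¬∀⟶∃¬ n _ (λ k → eval c (F k) Bool.≟ true) not-all-true)
    where
    F : Fin n → Poly n
    F k = pmFactor (lookup σ k) (lookup τ k) k
    not-all-true : ¬ (∀ k → eval c (F k) ≡ true)
    not-all-true all-true with () ← trans (sym pm≡false)
      (trans (cong (eval c) (pm≡∏ σ τ)) (Equivalence.from (eval-∏ c F) all-true))
    excludes : (∃ λ k → eval c (F k) ≢ true) → Excludes σ τ c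
    excludes (k , ≢true) with eval-pmFactor≢true (lookup σ k) (lookup τ k) k ≢true
    ... | inj₁ (σk , ck) = k , inj₁ (Vec.lookup⇒[]= k σ σk , lookup≡false⇒∉ ck)
    ... | inj₂ (τk , ck) = k , inj₂ (Vec.lookup⇒[]= k τ τk , Vec.lookup⇒[]= k c ck)

module _ {n : ℕ} (C : Code n) where

  Generator : Poly n → Set
  Generator g = ∃ λ v → ¬ C v × g ≡ ρ v

  combination : List (Σ (Poly n) Generator × Poly n) → Poly n
  combination = sumOver (λ term → proj₂ term *P proj₁ (proj₁ term))

  NeuralIdeal-resp-≃ : ∀ {f g} → f ≃ g → NeuralIdeal C f → NeuralIdeal C g
  NeuralIdeal-resp-≃ {f} f≃g (hs , f≈comb) =
    hs , ≃⇒≈ (≃-trans (≃-sym f≃g) (≈⇒≃ {p = f} {q = combination hs} f≈comb))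

  sumOver-ρ∈NeuralIdeal : ∀ ws → (∀ {w} → w ∈ ws → ¬ C w) → NeuralIdeal C (sumOver ρ ws)
  sumOver-ρ∈NeuralIdeal []       _        = [] , λ α → refl
  sumOver-ρ∈NeuralIdeal (w ∷ ws) ws∉C
    with hs , ws≈comb ← sumOver-ρ∈NeuralIdeal ws (ws∉C ∘ Any.there) =
    ((ρ w , w , ws∉C (Any.here refl) , refl) , 1P) ∷ hs ,
    ≃⇒≈ (+-cong (≃-sym (*-identityˡ (ρ w))) (≈⇒≃ {p = sumOver ρ ws} {q = combination hs} ws≈comb))

  module _ {c : Subset n} (c∈C : C c) where

    eval-combination : ∀ hs → eval c (combination hs) ≡ false
    eval-combination []                                = refl
    eval-combination (((_ , v , v∉C , refl) , h) ∷ hs) = begin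
      eval c (h *P ρ v +P combination hs)            ≡⟨ eval-+P c (h *P ρ v) (combination hs) ⟩
      eval c (h *P ρ v) xor eval c (combination hs)  ≡⟨ cong₂ _xor_ (eval-*P c h (ρ v)) (eval-combination hs) ⟩
      (eval c h ∧ eval c (ρ v)) xor false            ≡⟨ cong (λ b → (eval c h ∧ b) xor false) ρv≡false ⟩
      (eval c h ∧ false) xor false                   ≡⟨ cong (_xor false) (∧-zeroʳ (eval c h)) ⟩
      false                                          ∎
      where
      open ≡-Reasoning
      ρv≡false : eval c (ρ v) ≡ false
      ρv≡false = ¬-not λ ρv≡true → v∉C (subst C (sym (eval-ρ c v ρv≡true)) c∈C)

    NeuralIdeal-vanishes-on-code : ∀ {f} → NeuralIdeal C f → eval c f ≡ false
    NeuralIdeal-vanishes-on-code {f} (hs , f≈comb) =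
      trans (eval-≃ c (≈⇒≃ {p = f} {q = combination hs} f≈comb)) (eval-combination hs)

  pm∈NeuralIdeal⇔vanishes-on-code : ∀ σ τ →
    NeuralIdeal C (pm σ τ) ⇔ (∀ c → C c → eval c (pm σ τ) ≡ false)
  pm∈NeuralIdeal⇔vanishes-on-code σ τ = mk⇔
    (λ pm∈J c c∈C → NeuralIdeal-vanishes-on-code c∈C {pm σ τ} pm∈J)
    (λ vanishes → NeuralIdeal-resp-≃ (≃-sym (pm-expansion σ τ)) (sumOver-ρ∈NeuralIdeal (support σ τ)
      λ {w} w∈ w∈C → true≢false (trans (sym (eval-support w σ τ w∈)) (vanishes w w∈C))))
    where
    true≢false : true ≢ false
    true≢false ()

-- The prefix code

prefix : ∀ n → ℕ → Subset n
prefix zero    t       = []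
prefix (suc n) zero    = false ∷ prefix n zero
prefix (suc n) (suc t) = true ∷ prefix n t

∈-prefix⇒< : ∀ {n} t (k : Fin n) → k ∈ₛ prefix n t → toℕ k ℕ.< t
∈-prefix⇒< (suc t) Fin.zero    here       = s≤s z≤n
∈-prefix⇒< zero    (Fin.suc k) (there k∈) with () ← ∈-prefix⇒< zero k k∈
∈-prefix⇒< (suc t) (Fin.suc k) (there k∈) = s≤s (∈-prefix⇒< t k k∈)

<⇒∈-prefix : ∀ {n} t (k : Fin n) → toℕ k ℕ.< t → k ∈ₛ prefix n t
<⇒∈-prefix (suc t) Fin.zero    _         = here
<⇒∈-prefix (suc t) (Fin.suc k) (s≤s k<t) = there (<⇒∈-prefix t k k<t)

prefix∈PrefixCode : ∀ {n t} → t ≤ n → PrefixCode n (prefix n t)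
prefix∈PrefixCode {n} {t} t≤n = t , t≤n , λ k → mk⇔ (∈-prefix⇒< t k) (<⇒∈-prefix t k)

PrefixCode-downClosed : ∀ {n} {c : Subset n} → PrefixCode n c → ∀ {i j} → j < i → i ∈ₛ c → j ∈ₛ c
PrefixCode-downClosed (t , _ , ∈c⇔<t) j<i i∈c =
  Equivalence.from (∈c⇔<t _) (ℕ.<-trans j<i (Equivalence.to (∈c⇔<t _) i∈c))

x[1-x]-vanishes-on-PrefixCode : ∀ {n} {c : Subset n} → PrefixCode n c →
  ∀ {i j} → j < i → eval c (var i *P (1P -P var j)) ≡ false
x[1-x]-vanishes-on-PrefixCode {n} {c} c∈C {i} {j} j<i = begin
  eval c (var i *P (1P -P var j))        ≡⟨ eval-*P c (var i) (1P -P var j) ⟩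
  eval c (var i) ∧ eval c (1P -P var j)  ≡⟨ cong₂ _∧_ (eval-var c i) (eval-1-var c j) ⟩
  lookup c i ∧ not (lookup c j)          ≡⟨ down-closed ⟩
  false                                  ∎
  where
  open ≡-Reasoning
  down-closed : lookup c i ∧ not (lookup c j) ≡ false
  down-closed with lookup c i in ci
  ... | false = refl
  ... | true  = cong not (Vec.[]=⇒lookup (PrefixCode-downClosed c∈C j<i (Vec.lookup⇒[]= i c ci)))

module _ {n : ℕ} {σ τ : Subset n} where

  excludes-empty⇒σ-nonempty : Excludes σ τ (prefix n 0) → ∃ λ k → k ∈ₛ σ
  excludes-empty⇒σ-nonempty (k , inj₁ (k∈σ , _))      = k , k∈σ
  excludes-empty⇒σ-nonempty (k , inj₂ (_ , k∈prefix)) with () ← ∈-prefix⇒< 0 k k∈prefix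

  excludes-full⇒τ-nonempty : Excludes σ τ (prefix n n) → ∃ λ k → k ∈ₛ τ
  excludes-full⇒τ-nonempty (k , inj₁ (_ , k∉prefix)) =
    contradiction (<⇒∈-prefix n k (Fin.toℕ<n k)) k∉prefix
  excludes-full⇒τ-nonempty (k , inj₂ (k∈τ , _))      = k , k∈τ

  excludes-prefixes⇒degree≥2 : (∀ {t} → t ≤ n → Excludes σ τ (prefix n t)) → 2 ≤ ∣ σ ∣ + ∣ τ ∣
  excludes-prefixes⇒degree≥2 excludes =
    ℕ.+-mono-≤ (∈⇒1≤∣∣ (proj₂ (excludes-empty⇒σ-nonempty (excludes z≤n))))
               (∈⇒1≤∣∣ (proj₂ (excludes-full⇒τ-nonempty (excludes ℕ.≤-refl))))

  -- Descend through τ: the prefix below j ∈ τ is excluded either by some element of σ above j,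
  -- which is the answer, or by a smaller element of τ.
  excludes-prefixes⇒crossing : Disjoint σ τ → (∀ {t} → t ≤ n → Excludes σ τ (prefix n t)) →
    ∃ λ i → ∃ λ j → i ∈ₛ σ × j ∈ₛ τ × j < i
  excludes-prefixes⇒crossing σ∩τ=∅ excludes
    with k , k∈τ ← excludes-full⇒τ-nonempty (excludes ℕ.≤-refl) = descend k (Fin.<-wellFounded k) k∈τ
    where
    descend : ∀ j → Acc _<_ j → j ∈ₛ τ → ∃ λ i → ∃ λ j → i ∈ₛ σ × j ∈ₛ τ × j < i
    descend j (acc rec) j∈τ with excludes (ℕ.<⇒≤ (Fin.toℕ<n j))
    ... | i , inj₁ (i∈σ , i∉prefix) =
      i , j , i∈σ , j∈τ ,
      Fin.≤∧≢⇒< (ℕ.≮⇒≥ (i∉prefix ∘ <⇒∈-prefix (toℕ j) i)) λ { refl → σ∩τ=∅ j (i∈σ , j∈τ) }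
    ... | i , inj₂ (i∈τ , i∈prefix) = descend i (rec (∈-prefix⇒< (toℕ j) i i∈prefix)) i∈τ

module _ (n : ℕ) where

  J : Poly n → Set
  J = NeuralIdeal (PrefixCode n)

  CrossTerm : Poly n → Set
  CrossTerm f = ∃ λ i → ∃ λ j → j < i × f ≈ var i *P (1P -P var j)

  pm∈J⇒excludes-prefixes : ∀ {σ τ} → J (pm σ τ) → ∀ {t} → t ≤ n → Excludes σ τ (prefix n t)
  pm∈J⇒excludes-prefixes {σ} {τ} pm∈J {t} t≤n = eval-pm≡false⇒excludes (prefix n t) σ τ
    (Equivalence.to (pm∈NeuralIdeal⇔vanishes-on-code (PrefixCode n) σ τ) pm∈J
      (prefix n t) (prefix∈PrefixCode t≤n))

  x[1-x]∈J : ∀ {i j} → j < i → J (pm ⁅ i ⁆ ⁅ j ⁆)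
  x[1-x]∈J {i} {j} j<i = Equivalence.from (pm∈NeuralIdeal⇔vanishes-on-code (PrefixCode n) ⁅ i ⁆ ⁅ j ⁆)
    λ c c∈C → trans (eval-≃ c (pm-singletons (Fin.<⇒≢ j<i ∘ sym))) (x[1-x]-vanishes-on-PrefixCode c∈C j<i)

  CF⇒CrossTerm : ∀ {f} → InCF J f → CrossTerm f
  CF⇒CrossTerm {f} (σ , τ , σ∩τ=∅ , f≈pm , f∈J , minimal) =
    conclude (excludes-prefixes⇒crossing σ∩τ=∅ (pm∈J⇒excludes-prefixes pm∈J))
    where
    f≃pm : f ≃ pm σ τ
    f≃pm = ≈⇒≃ {p = f} {q = pm σ τ} f≈pm
    pm∈J : J (pm σ τ)
    pm∈J = NeuralIdeal-resp-≃ (PrefixCode n) f≃pm f∈J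
    conclude : (∃ λ i → ∃ λ j → i ∈ₛ σ × j ∈ₛ τ × j < i) → CrossTerm f
    conclude (i , j , i∈σ , j∈τ , j<i) =
      [ (λ pm≃x[1-x] → i , j , j<i , ≃⇒≈ (≃-trans f≃pm pm≃x[1-x]))
      , (λ { (deg< , pm≃h*pm) → ⊥-elim (minimal (⁅ i ⁆ , ⁅ j ⁆ , pm (σ - i - j) (τ - i - j) ,
               singletons-disjoint (disjoint-∈⇒≢ σ∩τ=∅ i∈σ j∈τ) , x[1-x]∈J j<i , deg< ,
               ≃⇒≈ (≃-trans f≃pm pm≃h*pm))) })
      ]′ (pm-degree-two-or-divisible σ∩τ=∅ i∈σ j∈τ)

  CrossTerm⇒CF : ∀ {f} → CrossTerm f → InCF J f
  CrossTerm⇒CF {f} (i , j , j<i , f≈x[1-x]) =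
    ⁅ i ⁆ , ⁅ j ⁆ , singletons-disjoint i≢j , ≃⇒≈ f≃pm ,
    NeuralIdeal-resp-≃ (PrefixCode n) (≃-sym f≃pm) (x[1-x]∈J j<i) ,
    λ { (σ′ , τ′ , _ , _ , pm′∈J , deg< , _) → ℕ.<⇒≱ deg< (degree-bound σ′ τ′ pm′∈J) }
    where
    i≢j : i ≢ j
    i≢j = Fin.<⇒≢ j<i ∘ sym
    degree-bound : ∀ σ′ τ′ → J (pm σ′ τ′) → ∣ ⁅ i ⁆ ∣ + ∣ ⁅ j ⁆ ∣ ≤ ∣ σ′ ∣ + ∣ τ′ ∣
    degree-bound σ′ τ′ pm′∈J = subst (_≤ ∣ σ′ ∣ + ∣ τ′ ∣) (sym (∣⁅i⁆∣+∣⁅j⁆∣≡2 i≢j))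
      (excludes-prefixes⇒degree≥2 {σ = σ′} {τ = τ′} (pm∈J⇒excludes-prefixes pm′∈J))
    f≃pm : f ≃ pm ⁅ i ⁆ ⁅ j ⁆
    f≃pm = ≃-trans (≈⇒≃ {p = f} {q = var i *P (1P -P var j)} f≈x[1-x]) (≃-sym (pm-singletons i≢j))

mainTheorem13 : (m : ℕ) → 3 ≤ m → (f : Poly (m ∸ 1)) →
    InCF (NeuralIdeal (PrefixCode (m ∸ 1))) f ⇔
      (∃ λ (i : Fin (m ∸ 1)) → ∃ λ (j : Fin (m ∸ 1)) →
        j < i × f ≈ var i *P (1P -P var j))
mainTheorem13 m _ f = mk⇔ (CF⇒CrossTerm (m ∸ 1) {f}) (CrossTerm⇒CF (m ∸ 1) {f})
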